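{- Let $G=(V,E)$ be a finite simple graph with $n=|V|$. At any step $s$ of the Wavefront algorithm (described in the context) applied to $G$, \[|\mathcal{C}|\le \sum_{i=1}^{s}\binom{n}{i},\] and this bound is tight.
   Context: For $v\in V$, $N(v)$ is the neighborhood of $v$ and $N[v]=N(v)\cup\{v\}$. Zero forcing color change rule: a colored vertex with exactly one uncolored neighbor forces that neighbor to become colored. The closure $\mathrm{cl}(S)$ of $S\subseteq V$ is the set of colored vertices obtained from $S$ by applying the rule until no further vertex can be forced. Wavefront algorithm: initialize $\mathcal{C}\leftarrow\{(\emptyset,0)\}$. For $R=1,2,\dots,n$ (the iteration with $R=s$ is step $s$): for each $(S,r)\in\mathcal{C}$: for each $v\in V$: set $S'\leftarrow \mathrm{cl}(S\cup N[v])$ and $r'\leftarrow r+|\{v\}\setminus S|+\max\{|N(v)\setminus S|-1,0\}$; if $r'\le R$ and there is no pair $(S',i)\in\mathcal{C}$ with $i\le R$, then add $(S',r')$ to $\mathcal{C}$, and if moreover $S'=V$, return $r'$. -}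

module Defs where

open import Data.Nat using (ℕ; zero; suc; _+_; _∸_; _≤ᵇ_; _≡ᵇ_)
open import Data.Nat.Combinatorics using (_C_)
open import Data.Bool using (Bool; true; false; _∧_; _∨_; not; if_then_else_)
open import Data.Fin using (Fin)
open import Data.Fin.Subset using (Subset; _∪_; _∩_; ∁; ⁅_⁆; ∣_∣; ⊤; ⊥)
open import Data.Vec using (Vec; []; _∷_; lookup; tabulate)
open import Data.List using (List; []; _∷_; _++_; [_]; allFin)
open import Data.Product using (_×_; _,_)
open import Relation.Binary.PropositionalEquality using (_≡_)

record Graph (n : ℕ) : Set where
  field
    adj    : Fin n → Fin n → Bool
    sym    : ∀ u v → adj u v ≡ adj v u
    irrefl : ∀ v → adj v v ≡ false
open Graph public

module _ {n : ℕ} (G : Graph n) where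

  N⟨_⟩ : Fin n → Subset n
  N⟨ v ⟩ = tabulate (adj G v)

  N[_] : Fin n → Subset n
  N[ v ] = N⟨ v ⟩ ∪ ⁅ v ⁆

anyFin : ∀ {n} → (Fin n → Bool) → Bool
anyFin {zero}  p = false
anyFin {suc n} p = p Fin.zero ∨ anyFin (λ i → p (Fin.suc i))

eqSub : ∀ {n} → Subset n → Subset n → Bool
eqSub [] [] = true
eqSub (a ∷ as) (b ∷ bs) = (if a then b else not b) ∧ eqSub as bs

module _ {n : ℕ} (G : Graph n) where

  -- one round of the zero forcing colour change rule, applied to every
  -- currently valid force: u becomes coloured if some coloured w adjacent
  -- to u has exactly one uncoloured neighbour (which is then u).
  forceRound : Subset n → Subset n
  forceRound S = tabulate λ u →
    lookup S u ∨ anyFin (λ w → lookup S w ∧ adj G w u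
                                ∧ (∣ N⟨ G ⟩ w ∩ ∁ S ∣ ≡ᵇ 1))

  iterate : ℕ → Subset n → Subset n
  iterate zero    S = S
  iterate (suc k) S = iterate k (forceRound S)

  -- closure cl(S): every round either adds a vertex or is a fixed point,
  -- so n rounds reach the closure.
  cl : Subset n → Subset n
  cl S = iterate n S

Pairs : ℕ → Set
Pairs n = List (Subset n × ℕ)

data Res (n : ℕ) : Set where
  running  : Pairs n → Res n
  returned : Pairs n → ℕ → Res n

anyL : ∀ {n} → (Subset n × ℕ → Bool) → Pairs n → Bool
anyL p []       = false
anyL p (x ∷ xs) = p x ∨ anyL p xs

module _ {n : ℕ} (G : Graph n) where

  cost : Subset n → ℕ → Fin n → ℕ
  cost S r v = r + (if lookup S v then 0 else 1) + (∣ N⟨ G ⟩ v ∩ ∁ S ∣ ∸ 1)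

  tryAdd : ℕ → Subset n × ℕ → Fin n → Pairs n → Res n
  tryAdd R (S , r) v 𝒞 =
    let S' = cl G (S ∪ N[ G ] v)
        r' = cost S r v
    in if (r' ≤ᵇ R) ∧ not (anyL (λ { (T , i) → eqSub T S' ∧ (i ≤ᵇ R) }) 𝒞)
       then (if eqSub S' ⊤
             then returned (𝒞 ++ [ (S' , r') ]) r'
             else running (𝒞 ++ [ (S' , r') ]))
       else running 𝒞

  loopV : ℕ → Subset n × ℕ → List (Fin n) → Pairs n → Res n
  loopV R p []       𝒞 = running 𝒞
  loopV R p (v ∷ vs) 𝒞 with tryAdd R p v 𝒞
  ... | running 𝒞'    = loopV R p vs 𝒞'
  ... | returned 𝒞' r = returned 𝒞' r

  -- for each (S,r) ∈ 𝒞 (𝒞 as it was at the start of the step, in insertion order)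
  loopC : ℕ → Pairs n → Pairs n → Res n
  loopC R []       𝒞 = running 𝒞
  loopC R (p ∷ ps) 𝒞 with loopV R p (allFin n) 𝒞
  ... | running 𝒞'    = loopC R ps 𝒞'
  ... | returned 𝒞' r = returned 𝒞' r

  step : ℕ → Pairs n → Res n
  step R 𝒞 = loopC R 𝒞 𝒞

  runSteps : ℕ → Res n
  runSteps zero    = running [ (⊥ , 0) ]
  runSteps (suc s) with runSteps s
  ... | running 𝒞    = step (suc s) 𝒞
  ... | returned 𝒞 r = returned 𝒞 r

  𝒞-at : ℕ → Pairs n
  𝒞-at s with runSteps s
  ... | running 𝒞    = 𝒞
  ... | returned 𝒞 _ = 𝒞

binomSum : ℕ → ℕ → ℕ
binomSum n zero    = 0
binomSum n (suc s) = binomSum n s + n C suc s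

module Submission where

-- Upper bound: by induction over the steps, after step R the collection 𝒞 is
-- well formed (distinct sets, ranks ≤ R) and every pair (S , r) is witnessed
-- (S = cl T with |T| ≤ r).  The key is the witness lemma: cl (cl T ∪ N[v]) =
-- cl (T ∪ A), where A is N[v] ∖ cl T minus one uncoloured neighbour x of v
-- (inside the closed set cl (T ∪ A) the vertex v forces x), so |T ∪ A| ≤ r'.
-- Thus the sets of 𝒞 at step s are distinct closures of sets of size ≤ s and
-- pigeonhole bounds |𝒞| by 1 + ∑_{i=1}^{s} C(n,i), the number of such sets.
-- Tightness: on the edgeless graph cl is the identity and ranks are sizes, so
-- every subset of size ≤ s ≤ n lies in 𝒞 at step s.

open import Defs
open import Data.Nat using (ℕ; _≤_; _+_)
open import Data.List using (length)
open import Data.Product using (_×_; Σ)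
open import Relation.Binary.PropositionalEquality using (_≡_)

open import Data.Nat using (zero; suc; _∸_; _<_; z≤n; s≤s; _≤ᵇ_; _≡ᵇ_)
open import Data.Nat.Properties
open import Data.Nat.Combinatorics using (nCk+nC[k+1]≡[n+1]C[k+1]) renaming (_C_ to _choose_)
open import Algebra.Properties.CommutativeSemigroup +-commutativeSemigroup using (interchange)
open import Data.Bool using (Bool; true; false; _∧_; _∨_; not; if_then_else_; T)
open import Data.Bool.Properties using (∧-zeroʳ; ∨-identityʳ)
open import Data.Fin using (Fin)
import Data.Fin as F
open import Data.Fin.Subset using (Subset; _∪_; _∩_; ∁; ⁅_⁆; ∣_∣; ⊤; ⊥)
open import Data.Fin.Subset.Properties using (∣⊥∣≡0; ∣⊤∣≡n; ∣p∣≡n⇒p≡⊤)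
open import Data.Vec using ([]; _∷_; lookup; tabulate)
open import Data.Vec.Properties using (lookup-map; lookup-zipWith; lookup-replicate; lookup∘tabulate; tabulate∘lookup; tabulate-cong; ∷-injectiveʳ)
open import Data.List using (List; []; _∷_; _++_; [_]; allFin; map)
import Data.List.Properties as List
open import Data.List.Relation.Unary.All as All using (All; []; _∷_)
import Data.List.Relation.Unary.All.Properties as All
open import Data.List.Relation.Unary.Any as Any using (Any; here; there)
open import Data.List.Relation.Unary.Unique.Propositional using (Unique)
open import Data.List.Relation.Unary.AllPairs using ([]; _∷_)
import Data.List.Relation.Unary.Unique.Propositional.Properties as Unique
open import Data.List.Membership.Propositional using (_∈_; find)
open import Data.List.Membership.Propositional.Properties using (∈-map⁺; ∈-map⁻; ∈-++⁺ˡ; ∈-++⁺ʳ; ∈-++⁻; ∈-∃++; ∈-allFin)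
open import Data.List.Relation.Binary.Subset.Propositional using () renaming (_⊆_ to _⊆ₗ_)
import Data.List.Relation.Binary.Subset.Propositional.Properties as Subsetₗ
open import Data.Product using (_,_; proj₁; proj₂; ∃₂)
open import Data.Sum using (_⊎_; inj₁; inj₂)
open import Data.Empty using (⊥-elim) renaming (⊥ to Empty)
open import Data.Unit using (tt) renaming (⊤ to Unit)
open import Relation.Binary.PropositionalEquality using (refl; trans; cong; cong₂; subst; subst₂; _≢_; module ≡-Reasoning) renaming (sym to ≡-sym)
open import Relation.Nullary using (¬_)

ind : Bool → ℕ
ind true  = 1
ind false = 0

∧-trueˡ : ∀ {a b} → a ∧ b ≡ true → a ≡ true
∧-trueˡ {true} _ = refl

∧-trueʳ : ∀ {a b} → a ∧ b ≡ true → b ≡ true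
∧-trueʳ {true} e = e

∧-true : ∀ {a b} → a ≡ true → b ≡ true → a ∧ b ≡ true
∧-true refl refl = refl

∨-trueˡ : ∀ {a} b → a ≡ true → a ∨ b ≡ true
∨-trueˡ b refl = refl

∨-trueʳ : ∀ a {b} → b ≡ true → a ∨ b ≡ true
∨-trueʳ true  _ = refl
∨-trueʳ false e = e

∨-true⁻ : ∀ {a b} → a ∨ b ≡ true → a ≡ true ⊎ b ≡ true
∨-true⁻ {true}  _ = inj₁ refl
∨-true⁻ {false} e = inj₂ e

not-true⁻ : ∀ {a} → not a ≡ true → a ≡ false
not-true⁻ {false} _ = refl

not-true⁺ : ∀ {a} → a ≡ false → not a ≡ true
not-true⁺ refl = refl

true≢false : ∀ {a} → a ≡ true → a ≡ false → Empty
true≢false refl ()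

false-if-not-true : ∀ {a} → ¬ (a ≡ true) → a ≡ false
false-if-not-true {true}  ne = ⊥-elim (ne refl)
false-if-not-true {false} _  = refl

bool-ext : ∀ {a b} → (a ≡ true → b ≡ true) → (b ≡ true → a ≡ true) → a ≡ b
bool-ext {true}  {true}  f g = refl
bool-ext {true}  {false} f g = ≡-sym (f refl)
bool-ext {false} {true}  f g = g refl
bool-ext {false} {false} f g = refl

eqFin : ∀ {n} → Fin n → Fin n → Bool
eqFin F.zero    F.zero    = true
eqFin F.zero    (F.suc j) = false
eqFin (F.suc i) F.zero    = false
eqFin (F.suc i) (F.suc j) = eqFin i j

eqFin-refl : ∀ {n} (i : Fin n) → eqFin i i ≡ true
eqFin-refl F.zero    = refl
eqFin-refl (F.suc i) = eqFin-refl i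

eqFin-sound : ∀ {n} {i j : Fin n} → eqFin i j ≡ true → i ≡ j
eqFin-sound {i = F.zero}  {F.zero}  e = refl
eqFin-sound {i = F.suc i} {F.suc j} e = cong F.suc (eqFin-sound e)

eqFin-≢ : ∀ {n} {i j : Fin n} → i ≢ j → eqFin i j ≡ false
eqFin-≢ ne = false-if-not-true (λ e → ne (eqFin-sound e))

-- Counting the elements satisfying a Boolean predicate on Fin n; all size
-- computations reduce to pointwise identities between indicators.

count : ∀ {n} → (Fin n → Bool) → ℕ
count {zero}  f = 0
count {suc n} f = ind (f F.zero) + count (λ i → f (F.suc i))

∣∣≡count : ∀ {n} (X : Subset n) → ∣ X ∣ ≡ count (lookup X)
∣∣≡count []          = refl
∣∣≡count (true ∷ X)  = cong suc (∣∣≡count X)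
∣∣≡count (false ∷ X) = ∣∣≡count X

count-cong : ∀ {n} {f g : Fin n → Bool} → (∀ i → f i ≡ g i) → count f ≡ count g
count-cong {zero}  e = refl
count-cong {suc n} e = cong₂ _+_ (cong ind (e F.zero)) (count-cong (λ i → e (F.suc i)))

count-additive : ∀ {n} {f g h k : Fin n → Bool} →
  (∀ i → ind (f i) + ind (g i) ≡ ind (h i) + ind (k i)) → count f + count g ≡ count h + count k
count-additive {zero}  e = refl
count-additive {suc n} {f} {g} {h} {k} e = begin
  (ind (f F.zero) + count f′) + (ind (g F.zero) + count g′) ≡⟨ interchange (ind (f F.zero)) (count f′) (ind (g F.zero)) (count g′) ⟩
  (ind (f F.zero) + ind (g F.zero)) + (count f′ + count g′) ≡⟨ cong₂ _+_ (e F.zero) (count-additive (λ i → e (F.suc i))) ⟩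
  (ind (h F.zero) + ind (k F.zero)) + (count h′ + count k′) ≡⟨ interchange (ind (h F.zero)) (ind (k F.zero)) (count h′) (count k′) ⟩
  (ind (h F.zero) + count h′) + (ind (k F.zero) + count k′) ∎
  where
    open ≡-Reasoning
    f′ g′ h′ k′ : Fin _ → Bool
    f′ i = f (F.suc i)
    g′ i = g (F.suc i)
    h′ i = h (F.suc i)
    k′ i = k (F.suc i)

count-false : ∀ {n} → count {n} (λ _ → false) ≡ 0
count-false {zero}  = refl
count-false {suc n} = count-false {n}

count-true : ∀ {n} → count {n} (λ _ → true) ≡ n
count-true {zero}  = refl
count-true {suc n} = cong suc (count-true {n})

count-mono : ∀ {n} {f g : Fin n → Bool} → (∀ i → f i ≡ true → g i ≡ true) → count f ≤ count g
count-mono {zero}  h = z≤n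
count-mono {suc n} h = +-mono-≤ (ind-mono (h F.zero)) (count-mono (λ i → h (F.suc i)))
  where
    ind-mono : ∀ {a b} → (a ≡ true → b ≡ true) → ind a ≤ ind b
    ind-mono {false} _ = z≤n
    ind-mono {true}  f with f refl
    ... | refl = ≤-refl

count-≤ : ∀ {n} (f : Fin n → Bool) → count f ≤ n
count-≤ {n} f = subst (count f ≤_) (count-true {n}) (count-mono {n} {f} {λ _ → true} (λ _ _ → refl))

count-single : ∀ {n} (v : Fin n) (g : Fin n → Bool) → count (λ i → eqFin i v ∧ g i) ≡ ind (g v)
count-single {suc n} F.zero g = begin
  ind (g F.zero) + count {n} (λ _ → false) ≡⟨ cong (ind (g F.zero) +_) (count-false {n}) ⟩
  ind (g F.zero) + 0                       ≡⟨ +-identityʳ _ ⟩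
  ind (g F.zero)                           ∎
  where open ≡-Reasoning
count-single {suc n} (F.suc v) g = count-single v (λ i → g (F.suc i))

count-pos : ∀ {n} {f : Fin n → Bool} (i : Fin n) → f i ≡ true → 1 ≤ count f
count-pos {n} {f} i fi = subst (_≤ count f) (count-single i (λ _ → true))
  (count-mono {n} {λ j → eqFin j i ∧ true} {f} (λ j h → subst (λ x → f x ≡ true) (≡-sym (eqFin-sound (∧-trueˡ h))) fi))

count-zero : ∀ {n} (f : Fin n → Bool) → count f ≡ 0 → ∀ i → f i ≡ false
count-zero f e i = false-if-not-true (λ fi → <⇒≱ (subst (1 ≤_) e (count-pos {f = f} i fi)) z≤n)

count-witness : ∀ {n} (f : Fin n → Bool) → 1 ≤ count f → Σ (Fin n) (λ i → f i ≡ true)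
count-witness {suc n} f h with f F.zero in e
... | true  = F.zero , e
... | false = let (i , e′) = count-witness (λ i → f (F.suc i)) h in F.suc i , e′

count-strict : ∀ {n} (f g : Fin n → Bool) → (∀ i → f i ≡ true → g i ≡ true) →
               (∀ i → g i ≡ f i) ⊎ (count f < count g)
count-strict {zero} f g h = inj₁ (λ ())
count-strict {suc n} f g h
  with f F.zero in e₁ | g F.zero in e₂ | count-strict (λ i → f (F.suc i)) (λ i → g (F.suc i)) (λ i → h (F.suc i))
... | true  | false | _       = ⊥-elim (true≢false (h F.zero e₁) e₂)
... | false | true  | _       = inj₂ (s≤s (count-mono (λ i → h (F.suc i))))
... | true  | true  | inj₂ lt = inj₂ (s≤s lt)
... | false | false | inj₂ lt = inj₂ lt
... | true  | true  | inj₁ eq = inj₁ λ { F.zero → trans e₂ (≡-sym e₁) ; (F.suc i) → eq i }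
... | false | false | inj₁ eq = inj₁ λ { F.zero → trans e₂ (≡-sym e₁) ; (F.suc i) → eq i }

module _ {n : ℕ} where

  _⊑_ : Subset n → Subset n → Set
  X ⊑ Y = ∀ i → lookup X i ≡ true → lookup Y i ≡ true

  subset-ext : {X Y : Subset n} → (∀ i → lookup X i ≡ lookup Y i) → X ≡ Y
  subset-ext {X} {Y} e = trans (≡-sym (tabulate∘lookup X)) (trans (tabulate-cong e) (tabulate∘lookup Y))

  ⊑-antisym : {X Y : Subset n} → X ⊑ Y → Y ⊑ X → X ≡ Y
  ⊑-antisym f g = subset-ext (λ i → bool-ext (f i) (g i))

  ⊑-false : {X Y : Subset n} → X ⊑ Y → ∀ i → lookup Y i ≡ false → lookup X i ≡ false
  ⊑-false h i yi = false-if-not-true (λ xi → true≢false (h i xi) yi)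

  lookup-∪ : (X Y : Subset n) (i : Fin n) → lookup (X ∪ Y) i ≡ (lookup X i ∨ lookup Y i)
  lookup-∪ X Y i = lookup-zipWith _∨_ i X Y

  lookup-∁ : (X : Subset n) (i : Fin n) → lookup (∁ X) i ≡ not (lookup X i)
  lookup-∁ X i = lookup-map i not X

  lookup-⊥ : (i : Fin n) → lookup (⊥ {n}) i ≡ false
  lookup-⊥ i = lookup-replicate i false

  ⊑-∪ˡ : (X Y : Subset n) → X ⊑ (X ∪ Y)
  ⊑-∪ˡ X Y i xi = trans (lookup-∪ X Y i) (∨-trueˡ _ xi)

  ⊑-∪ʳ : (X Y : Subset n) → Y ⊑ (X ∪ Y)
  ⊑-∪ʳ X Y i yi = trans (lookup-∪ X Y i) (∨-trueʳ (lookup X i) yi)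

  ∪-⊑ : {X Y Z : Subset n} → X ⊑ Z → Y ⊑ Z → (X ∪ Y) ⊑ Z
  ∪-⊑ {X} {Y} f g i e with ∨-true⁻ {lookup X i} (trans (≡-sym (lookup-∪ X Y i)) e)
  ... | inj₁ xi = f i xi
  ... | inj₂ yi = g i yi

  ∣∪∣≤ : (X Y : Subset n) → ∣ X ∪ Y ∣ ≤ ∣ X ∣ + ∣ Y ∣
  ∣∪∣≤ X Y = subst₂ _≤_ (≡-sym (∣∣≡count (X ∪ Y))) (cong₂ _+_ (≡-sym (∣∣≡count X)) (≡-sym (∣∣≡count Y)))
    (subst (count (lookup (X ∪ Y)) ≤_) inclusion–exclusion (m≤m+n _ _))
    where
      ind-∨∧ : ∀ a b → ind (a ∨ b) + ind (a ∧ b) ≡ ind a + ind b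
      ind-∨∧ true  true  = refl
      ind-∨∧ true  false = refl
      ind-∨∧ false true  = refl
      ind-∨∧ false false = refl
      inclusion–exclusion : count (lookup (X ∪ Y)) + count (λ i → lookup X i ∧ lookup Y i)
                            ≡ count (lookup X) + count (lookup Y)
      inclusion–exclusion = count-additive (λ i →
        trans (cong (λ z → ind z + ind (lookup X i ∧ lookup Y i)) (lookup-∪ X Y i)) (ind-∨∧ (lookup X i) (lookup Y i)))

lookup-⁅⁆ : ∀ {n} (v i : Fin n) → lookup ⁅ v ⁆ i ≡ eqFin i v
lookup-⁅⁆ F.zero    F.zero    = refl
lookup-⁅⁆ F.zero    (F.suc i) = lookup-⊥ i
lookup-⁅⁆ (F.suc v) F.zero    = refl
lookup-⁅⁆ (F.suc v) (F.suc i) = lookup-⁅⁆ v i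

anyFin-true : ∀ {n} (p : Fin n → Bool) (i : Fin n) → p i ≡ true → anyFin p ≡ true
anyFin-true p F.zero    e = ∨-trueˡ _ e
anyFin-true p (F.suc i) e = ∨-trueʳ (p F.zero) (anyFin-true (λ j → p (F.suc j)) i e)

anyFin-witness : ∀ {n} (p : Fin n → Bool) → anyFin p ≡ true → Σ (Fin n) (λ i → p i ≡ true)
anyFin-witness {suc n} p e with ∨-true⁻ {p F.zero} e
... | inj₁ e′ = F.zero , e′
... | inj₂ e′ = let (i , e″) = anyFin-witness (λ j → p (F.suc j)) e′ in F.suc i , e″

anyFin-false : ∀ {n} (p : Fin n → Bool) → (∀ i → p i ≡ false) → anyFin p ≡ false
anyFin-false {zero}  p h = refl
anyFin-false {suc n} p h rewrite h F.zero = anyFin-false (λ j → p (F.suc j)) (λ j → h (F.suc j))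

-- The closure operator: cl X is the least closed superset of X.

module Closure {n : ℕ} (G : Graph n) where

  uncoloured : Fin n → Subset n → Fin n → Bool
  uncoloured w S i = adj G w i ∧ not (lookup S i)

  ∣uncoloured∣ : (w : Fin n) (S : Subset n) → ∣ N⟨ G ⟩ w ∩ ∁ S ∣ ≡ count (uncoloured w S)
  ∣uncoloured∣ w S = trans (∣∣≡count (N⟨ G ⟩ w ∩ ∁ S)) (count-cong λ i →
    trans (lookup-zipWith _∧_ i (N⟨ G ⟩ w) (∁ S)) (cong₂ _∧_ (lookup∘tabulate (adj G w) i) (lookup-∁ S i)))

  lookup-N[] : (v i : Fin n) → lookup (N[ G ] v) i ≡ (adj G v i ∨ eqFin i v)
  lookup-N[] v i = trans (lookup-∪ (N⟨ G ⟩ v) ⁅ v ⁆ i) (cong₂ _∨_ (lookup∘tabulate (adj G v) i) (lookup-⁅⁆ v i))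

  forces : Subset n → Fin n → Fin n → Bool
  forces S u w = lookup S w ∧ adj G w u ∧ (∣ N⟨ G ⟩ w ∩ ∁ S ∣ ≡ᵇ 1)

  lookup-forceRound : (S : Subset n) (u : Fin n) → lookup (forceRound G S) u ≡ (lookup S u ∨ anyFin (forces S u))
  lookup-forceRound S u = lookup∘tabulate _ u

  ≡ᵇ1⇒≡1 : ∀ m → (m ≡ᵇ 1) ≡ true → m ≡ 1
  ≡ᵇ1⇒≡1 (suc zero) _ = refl

  ≡1⇒≡ᵇ1 : ∀ {m} → m ≡ 1 → (m ≡ᵇ 1) ≡ true
  ≡1⇒≡ᵇ1 refl = refl

  forceRound-ext : (X : Subset n) → X ⊑ forceRound G X
  forceRound-ext X i e = trans (lookup-forceRound X i) (∨-trueˡ _ e)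

  forces-one : (S : Subset n) (w u : Fin n) → lookup S w ≡ true → adj G w u ≡ true →
               count (uncoloured w S) ≡ 1 → lookup (forceRound G S) u ≡ true
  forces-one S w u sw wu one = trans (lookup-forceRound S u) (∨-trueʳ (lookup S u)
    (anyFin-true _ w (∧-true sw (∧-true wu (≡1⇒≡ᵇ1 (trans (∣uncoloured∣ w S) one))))))

  count-one : ∀ {f : Fin n → Bool} x → f x ≡ true → count f ≤ 1 → count f ≡ 1
  count-one {f} x fx le = ≤-antisym le (count-pos {f = f} x fx)

  uncoloured-anti : {X Y : Subset n} → X ⊑ Y → ∀ w i → uncoloured w Y i ≡ true → uncoloured w X i ≡ true
  uncoloured-anti {X} {Y} h w i e =
    ∧-true (∧-trueˡ {adj G w i} e) (not-true⁺ (⊑-false {X = X} {Y = Y} h i (not-true⁻ (∧-trueʳ {adj G w i} e))))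

  -- a force valid in X stays valid in any larger Y that does not yet contain its target
  forceRound-mono : (X Y : Subset n) → X ⊑ Y → forceRound G X ⊑ forceRound G Y
  forceRound-mono X Y h u e with lookup Y u in yu
  ... | true = forceRound-ext Y u yu
  ... | false with ∨-true⁻ {lookup X u} (trans (≡-sym (lookup-forceRound X u)) e)
  ...   | inj₁ xu   = ⊥-elim (true≢false (h u xu) yu)
  ...   | inj₂ some with anyFin-witness (forces X u) some
  ...     | w , fw = forces-one Y w u (h w (∧-trueˡ fw)) wu (count-one u (∧-true wu (not-true⁺ yu))
                       (subst (count (uncoloured w Y) ≤_) one-in-X (count-mono (uncoloured-anti {X = X} {Y = Y} h w))))
    where
      wu : adj G w u ≡ true
      wu = ∧-trueˡ (∧-trueʳ {lookup X w} fw)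
      one-in-X : count (uncoloured w X) ≡ 1
      one-in-X = trans (≡-sym (∣uncoloured∣ w X)) (≡ᵇ1⇒≡1 _ (∧-trueʳ {adj G w u} (∧-trueʳ {lookup X w} fw)))

  iterate-suc : (k : ℕ) (X : Subset n) → iterate G (suc k) X ≡ forceRound G (iterate G k X)
  iterate-suc zero    X = refl
  iterate-suc (suc k) X = iterate-suc k (forceRound G X)

  iterate-mono : (k : ℕ) (X Y : Subset n) → X ⊑ Y → iterate G k X ⊑ iterate G k Y
  iterate-mono zero    X Y h = h
  iterate-mono (suc k) X Y h = iterate-mono k _ _ (forceRound-mono X Y h)

  iterate-ext : (k : ℕ) (X : Subset n) → X ⊑ iterate G k X
  iterate-ext zero    X i e = e
  iterate-ext (suc k) X i e = iterate-ext k (forceRound G X) i (forceRound-ext X i e)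

  Closed : Subset n → Set
  Closed X = forceRound G X ≡ X

  iterate-closed : (k : ℕ) (X : Subset n) → Closed X → iterate G k X ≡ X
  iterate-closed zero    X c = refl
  iterate-closed (suc k) X c = trans (cong (iterate G k) c) (iterate-closed k X c)

  round-progress : (Y : Subset n) → Closed Y ⊎ (count (lookup Y) < count (lookup (forceRound G Y)))
  round-progress Y with count-strict (lookup Y) (lookup (forceRound G Y)) (forceRound-ext Y)
  ... | inj₁ eq = inj₁ (subset-ext {X = forceRound G Y} {Y = Y} eq)
  ... | inj₂ lt = inj₂ lt

  iterate-progress : (k : ℕ) (X : Subset n) → Closed (iterate G k X) ⊎ (k ≤ count (lookup (iterate G k X)))
  iterate-progress zero    X = inj₂ z≤n
  iterate-progress (suc k) X =
    subst (λ Z → Closed Z ⊎ (suc k ≤ count (lookup Z))) (≡-sym (iterate-suc k X))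
      (next (iterate-progress k X) (round-progress (iterate G k X)))
    where
      next : ∀ {Y} → Closed Y ⊎ (k ≤ count (lookup Y)) → Closed Y ⊎ (count (lookup Y) < count (lookup (forceRound G Y))) →
             Closed (forceRound G Y) ⊎ (suc k ≤ count (lookup (forceRound G Y)))
      next (inj₁ c)  _        = inj₁ (subst Closed (≡-sym c) c)
      next (inj₂ _)  (inj₁ c) = inj₁ (subst Closed (≡-sym c) c)
      next (inj₂ le) (inj₂ lt) = inj₂ (≤-trans (s≤s le) lt)

  -- n rounds suffice to reach a closed set, as at most n vertices can be coloured
  cl-closed : (X : Subset n) → Closed (cl G X)
  cl-closed X with iterate-progress n X | round-progress (cl G X)
  ... | inj₁ c  | _       = c
  ... | inj₂ _  | inj₁ c  = c
  ... | inj₂ le | inj₂ lt = ⊥-elim (<⇒≱ (≤-trans (s≤s le) lt) (count-≤ _))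

  cl-ext : (X : Subset n) → X ⊑ cl G X
  cl-ext = iterate-ext n

  cl-mono : (X Y : Subset n) → X ⊑ Y → cl G X ⊑ cl G Y
  cl-mono = iterate-mono n

  cl-least : (X Z : Subset n) → X ⊑ cl G Z → cl G X ⊑ cl G Z
  cl-least X Z h i e = subst (λ W → lookup W i ≡ true) (iterate-closed n _ (cl-closed Z)) (cl-mono X (cl G Z) h i e)

  -- in a closed set, a coloured vertex w all of whose neighbours but x are
  -- coloured has x coloured as well (otherwise w would force x)
  closed-forces : (Z : Subset n) → Closed Z → (w x : Fin n) → lookup Z w ≡ true → adj G w x ≡ true →
                  (∀ j → adj G w j ≡ true → eqFin j x ≡ false → lookup Z j ≡ true) → lookup Z x ≡ true
  closed-forces Z c w x zw wx others with lookup Z x in zx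
  ... | true  = refl
  ... | false = ⊥-elim (true≢false (subst (λ W → lookup W x ≡ true) c
                  (forces-one Z w x zw wx (count-one x (∧-true wx (not-true⁺ zx)) at-most-x))) zx)
    where
      only-x : ∀ j → uncoloured w Z j ≡ true → eqFin j x ∧ true ≡ true
      only-x j u with eqFin j x in jx
      ... | true  = refl
      ... | false = ⊥-elim (true≢false (others j (∧-trueˡ {adj G w j} u) jx) (not-true⁻ (∧-trueʳ {adj G w j} u)))
      at-most-x : count (uncoloured w Z) ≤ 1
      at-most-x = subst (count (uncoloured w Z) ≤_) (count-single x (λ _ → true)) (count-mono only-x)

  cl-⊥ : cl G ⊥ ≡ ⊥
  cl-⊥ = iterate-closed n ⊥ (subset-ext (λ u → begin
    lookup (forceRound G ⊥) u             ≡⟨ lookup-forceRound ⊥ u ⟩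
    lookup ⊥ u ∨ anyFin (forces ⊥ u)      ≡⟨ cong₂ _∨_ (lookup-⊥ u) (anyFin-false (forces ⊥ u) (λ w →
                                               cong (_∧ (adj G w u ∧ (∣ N⟨ G ⟩ w ∩ ∁ ⊥ ∣ ≡ᵇ 1))) (lookup-⊥ w))) ⟩
    false                                 ≡⟨ ≡-sym (lookup-⊥ u) ⟩
    lookup ⊥ u                            ∎))
    where open ≡-Reasoning

  extraCost : Subset n → Fin n → ℕ
  extraCost S v = (if lookup S v then 0 else 1) + (∣ N⟨ G ⟩ v ∩ ∁ S ∣ ∸ 1)

  cost≡ : (S : Subset n) (r : ℕ) (v : Fin n) → cost G S r v ≡ r + extraCost S v
  cost≡ S r v = +-assoc r _ _

  ind-not : ∀ b → ind (not b) ≡ (if b then 0 else 1)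
  ind-not true  = refl
  ind-not false = refl

  via-cl : (T A : Subset n) → cl G T ⊑ cl G (T ∪ A)
  via-cl T A = cl-mono T (T ∪ A) (⊑-∪ˡ T A)

  via-A : (T A : Subset n) → A ⊑ cl G (T ∪ A)
  via-A T A i a = cl-ext (T ∪ A) i (⊑-∪ʳ T A i a)

  closure-extension : (T A : Subset n) (v : Fin n) → A ⊑ N[ G ] v → N[ G ] v ⊑ cl G (T ∪ A) →
                      cl G (T ∪ A) ≡ cl G (cl G T ∪ N[ G ] v)
  closure-extension T A v A⊑N N⊑cl =
    ⊑-antisym (cl-mono (T ∪ A) (cl G T ∪ N[ G ] v) T∪A⊑) (cl-least (cl G T ∪ N[ G ] v) (T ∪ A) ⊑cl)
    where
      T∪A⊑ : (T ∪ A) ⊑ (cl G T ∪ N[ G ] v)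
      T∪A⊑ = ∪-⊑ {X = T} {Y = A} {Z = cl G T ∪ N[ G ] v}
               (λ i t → ⊑-∪ˡ (cl G T) (N[ G ] v) i (cl-ext T i t)) (λ i a → ⊑-∪ʳ (cl G T) (N[ G ] v) i (A⊑N i a))
      ⊑cl : (cl G T ∪ N[ G ] v) ⊑ cl G (T ∪ A)
      ⊑cl = ∪-⊑ {X = cl G T} {Y = N[ G ] v} {Z = cl G (T ∪ A)} (via-cl T A) N⊑cl

  Witness : Subset n → Fin n → Set
  Witness T v = Σ (Subset n) λ A → ∣ A ∣ ≤ extraCost (cl G T) v × cl G (T ∪ A) ≡ cl G (cl G T ∪ N[ G ] v)

  witness-no-uncoloured : (T : Subset n) (v : Fin n) → count (uncoloured v (cl G T)) ≡ 0 → Witness T v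
  witness-no-uncoloured T v none = A , size , closure-extension T A v A⊑N N⊑cl
    where
      S = cl G T
      A = tabulate (λ i → eqFin i v ∧ not (lookup S i))
      size : ∣ A ∣ ≤ extraCost S v
      size = ≤-trans (≤-reflexive (begin
        ∣ A ∣                                           ≡⟨ ∣∣≡count A ⟩
        count (lookup A)                                ≡⟨ count-cong (lookup∘tabulate (λ i → eqFin i v ∧ not (lookup S i))) ⟩
        count (λ i → eqFin i v ∧ not (lookup S i))      ≡⟨ count-single v (λ i → not (lookup S i)) ⟩
        ind (not (lookup S v))                          ≡⟨ ind-not (lookup S v) ⟩
        (if lookup S v then 0 else 1)                   ∎)) (m≤m+n _ _)
        where open ≡-Reasoning
      A⊑N : A ⊑ N[ G ] v
      A⊑N i a = trans (lookup-N[] v i) (∨-trueʳ (adj G v i) (∧-trueˡ (trans (≡-sym (lookup∘tabulate _ i)) a)))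
      N⊑cl : N[ G ] v ⊑ cl G (T ∪ A)
      N⊑cl i iN with lookup S i in si
      ... | true = via-cl T A i si
      ... | false with ∨-true⁻ {adj G v i} (trans (≡-sym (lookup-N[] v i)) iN)
      ...   | inj₂ iv = via-A T A i (trans (lookup∘tabulate _ i) (∧-true iv (not-true⁺ si)))
      ...   | inj₁ vi = ⊥-elim (true≢false (∧-true vi (not-true⁺ si)) (count-zero (uncoloured v S) none i))

  -- the indicator identity behind |A| + 1 = |N(v) ∖ S| + |{v} ∖ S| in the next lemma;
  -- a = [v ~ i], s = [i ∈ S], ex = [i = x], ev = [i = v]
  indicators : ∀ a s ex ev → (ex ≡ true → (a ≡ true) × (s ≡ false)) → (ev ≡ true → a ≡ false) →
               ind ((a ∨ ev) ∧ not s ∧ not ex) + ind (ex ∧ true) ≡ ind (a ∧ not s) + ind (ev ∧ not s)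
  indicators a s true ev hx hv with hx refl
  indicators .true .false true true  hx hv | refl , refl = ⊥-elim (true≢false refl (hv refl))
  indicators .true .false true false hx hv | refl , refl = refl
  indicators true  s     false true  hx hv = ⊥-elim (true≢false refl (hv refl))
  indicators true  true  false false hx hv = refl
  indicators true  false false false hx hv = refl
  indicators false true  false true  hx hv = refl
  indicators false true  false false hx hv = refl
  indicators false false false true  hx hv = refl
  indicators false false false false hx hv = refl

  N[_]∖_∖_ : Fin n → Subset n → Fin n → Fin n → Bool
  N[ v ]∖ S ∖ x = λ i → (adj G v i ∨ eqFin i v) ∧ not (lookup S i) ∧ not (eqFin i x)

  count-N[]∖∖ : (S : Subset n) (v x : Fin n) → adj G v x ≡ true → lookup S x ≡ false →
                count (N[ v ]∖ S ∖ x) ≡ extraCost S v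
  count-N[]∖∖ S v x vx sx = suc-injective (begin
    suc (count a)            ≡⟨ +-comm 1 (count a) ⟩
    count a + 1              ≡⟨ cong (count a +_) (≡-sym (count-single x (λ _ → true))) ⟩
    count a + count (λ i → eqFin i x ∧ true)
                             ≡⟨ count-additive (λ i → indicators (adj G v i) (lookup S i) (eqFin i x) (eqFin i v) (at-x i) (at-v i)) ⟩
    c + count (λ i → eqFin i v ∧ not (lookup S i))
                             ≡⟨ cong (c +_) (count-single v (λ i → not (lookup S i))) ⟩
    c + b                    ≡⟨ cong (_+ b) (≡-sym (m+[n∸m]≡n 1≤c)) ⟩
    suc ((c ∸ 1) + b)        ≡⟨ cong suc (+-comm (c ∸ 1) b) ⟩
    suc (b + (c ∸ 1))        ≡⟨ cong₂ (λ p q → suc (p + (q ∸ 1))) (ind-not (lookup S v)) (≡-sym (∣uncoloured∣ v S)) ⟩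
    suc (extraCost S v)      ∎)
    where
      open ≡-Reasoning
      a = N[ v ]∖ S ∖ x
      c = count (uncoloured v S)
      b = ind (not (lookup S v))
      1≤c : 1 ≤ c
      1≤c = count-pos {f = uncoloured v S} x (∧-true vx (not-true⁺ sx))
      at-x : ∀ i → eqFin i x ≡ true → (adj G v i ≡ true) × (lookup S i ≡ false)
      at-x i e with refl ← eqFin-sound {i = i} {x} e = vx , sx
      at-v : ∀ i → eqFin i v ≡ true → adj G v i ≡ false
      at-v i e with refl ← eqFin-sound {i = i} {v} e = irrefl G v

  -- if x is an uncoloured neighbour of v, A = N[v] ∖ (cl T ∪ {x}) works:
  -- in the closed set cl (T ∪ A) the vertex v has all neighbours but x, so x too
  witness-uncoloured : (T : Subset n) (v x : Fin n) → adj G v x ≡ true → lookup (cl G T) x ≡ false → Witness T v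
  witness-uncoloured T v x vx sx = A , size , closure-extension T A v A⊑N N⊑Z
    where
      S = cl G T
      A = tabulate (N[ v ]∖ S ∖ x)
      Z = cl G (T ∪ A)
      size : ∣ A ∣ ≤ extraCost S v
      size = ≤-reflexive (trans (∣∣≡count A) (trans (count-cong (lookup∘tabulate (N[ v ]∖ S ∖ x))) (count-N[]∖∖ S v x vx sx)))
      inA : ∀ i → adj G v i ∨ eqFin i v ≡ true → lookup S i ≡ false → eqFin i x ≡ false → lookup Z i ≡ true
      inA i iN si ix = via-A T A i (trans (lookup∘tabulate (N[ v ]∖ S ∖ x) i) (∧-true iN (∧-true (not-true⁺ si) (not-true⁺ ix))))
      N⊑Z-but-x : ∀ j → adj G v j ∨ eqFin j v ≡ true → eqFin j x ≡ false → lookup Z j ≡ true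
      N⊑Z-but-x j jN jx with lookup S j in sj
      ... | true  = via-cl T A j sj
      ... | false = inA j jN sj jx
      v≢x : eqFin v x ≡ false
      v≢x = eqFin-≢ (λ v≡x → true≢false (subst (λ j → adj G v j ≡ true) (≡-sym v≡x) vx) (irrefl G v))
      xZ : lookup Z x ≡ true
      xZ = closed-forces Z (cl-closed (T ∪ A)) v x (N⊑Z-but-x v (∨-trueʳ (adj G v v) (eqFin-refl v)) v≢x) vx
             (λ j vj jx → N⊑Z-but-x j (∨-trueˡ _ vj) jx)
      A⊑N : A ⊑ N[ G ] v
      A⊑N i e = trans (lookup-N[] v i) (∧-trueˡ (trans (≡-sym (lookup∘tabulate (N[ v ]∖ S ∖ x) i)) e))
      N⊑Z : N[ G ] v ⊑ Z
      N⊑Z i iN with eqFin i x in ix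
      ... | true  = subst (λ j → lookup Z j ≡ true) (≡-sym (eqFin-sound ix)) xZ
      ... | false = N⊑Z-but-x i (trans (≡-sym (lookup-N[] v i)) iN) ix

  witness : (T : Subset n) (v : Fin n) → Witness T v
  witness T v with count (uncoloured v (cl G T)) in c
  ... | zero  = witness-no-uncoloured T v c
  ... | suc _ with count-witness (uncoloured v (cl G T)) (subst (1 ≤_) (≡-sym c) (s≤s z≤n))
  ...   | x , ux = witness-uncoloured T v x (∧-trueˡ ux) (not-true⁻ (∧-trueʳ {adj G v x} ux))

eqSub-refl : ∀ {n} (X : Subset n) → eqSub X X ≡ true
eqSub-refl []          = refl
eqSub-refl (true ∷ X)  = eqSub-refl X
eqSub-refl (false ∷ X) = eqSub-refl X

eqSub-sound : ∀ {n} (X Y : Subset n) → eqSub X Y ≡ true → X ≡ Y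
eqSub-sound []          []          e = refl
eqSub-sound (true ∷ X)  (true ∷ Y)  e = cong (true ∷_) (eqSub-sound X Y e)
eqSub-sound (false ∷ X) (false ∷ Y) e = cong (false ∷_) (eqSub-sound X Y e)

anyL-true : ∀ {n} (test : Subset n × ℕ → Bool) (C : Pairs n) → anyL test C ≡ true → Any (λ x → test x ≡ true) C
anyL-true test (x ∷ C) e with ∨-true⁻ {test x} e
... | inj₁ h = here h
... | inj₂ h = there (anyL-true test C h)

anyL-false : ∀ {n} (test : Subset n × ℕ → Bool) (C : Pairs n) → anyL test C ≡ false → All (λ x → test x ≡ false) C
anyL-false test []      e = []
anyL-false test (x ∷ C) e with test x in tx
anyL-false test (x ∷ C) () | true
anyL-false test (x ∷ C) e  | false = tx ∷ anyL-false test C e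

≤ᵇ-sound : ∀ {a b} → (a ≤ᵇ b) ≡ true → a ≤ b
≤ᵇ-sound {a} {b} e = ≤ᵇ⇒≤ a b (subst T (≡-sym e) _)

≤ᵇ-complete : ∀ {a b} → a ≤ b → (a ≤ᵇ b) ≡ true
≤ᵇ-complete {a} {b} h with a ≤ᵇ b | ≤⇒≤ᵇ h
... | true | _ = refl

module Step {n : ℕ} (G : Graph n) where

  extend : Subset n × ℕ → Fin n → Subset n × ℕ
  extend p v = cl G (proj₁ p ∪ N[ G ] v) , cost G (proj₁ p) (proj₂ p) v

  sets : Pairs n → List (Subset n)
  sets = map proj₁

  final : Res n → Pairs n
  final (running C)    = C
  final (returned C _) = C

  𝒞-at≡final : ∀ s → 𝒞-at G s ≡ final (runSteps G s)
  𝒞-at≡final s with runSteps G s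
  ... | running C    = refl
  ... | returned C _ = refl

  WellFormed : ℕ → Pairs n → Set
  WellFormed R C = Unique (sets C) × All (λ x → proj₂ x ≤ R) C

  WellFormed-suc : ∀ {R C} → WellFormed R C → WellFormed (suc R) C
  WellFormed-suc (distinct , ranks) = distinct , All.map m≤n⇒m≤1+n ranks

  Generated : Pairs n → Subset n × ℕ → Set
  Generated C₀ x = ∃₂ λ p v → p ∈ C₀ × x ≡ extend p v

  Grows : Pairs n → Pairs n → Pairs n → Set
  Grows C₀ C C′ = C ⊆ₗ C′ × (∀ {x} → x ∈ C′ → x ∈ C ⊎ Generated C₀ x)

  grows-refl : ∀ {C₀ C} → Grows C₀ C C
  grows-refl = (λ x → x) , inj₁

  grows-trans : ∀ {C₀ C C₁ C₂} → Grows C₀ C C₁ → Grows C₀ C₁ C₂ → Grows C₀ C C₂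
  grows-trans (sub₁ , new₁) (sub₂ , new₂) = (λ x → sub₂ (sub₁ x)) , λ x∈ → trace (new₂ x∈)
    where
      trace : ∀ {x} → _ ⊎ Generated _ x → _ ⊎ Generated _ x
      trace (inj₁ x∈C₁) = new₁ x∈C₁
      trace (inj₂ g)    = inj₂ g

  Covers : ℕ → Pairs n → List (Fin n) → Pairs n → Set
  Covers R ps vs C′ = ∀ {p v} → p ∈ ps → v ∈ vs → proj₂ (extend p v) ≤ R → proj₁ (extend p v) ∈ sets C′

  covers-mono : ∀ {R ps vs C C′} → C ⊆ₗ C′ → Covers R ps vs C → Covers R ps vs C′
  covers-mono sub cov p∈ v∈ le = Subsetₗ.map⁺ proj₁ sub (cov p∈ v∈ le)

  -- what is known after running a part of step R on C, where C₀ is the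
  -- collection at the start of the step and Cov what the part achieves
  StepOK : ℕ → Pairs n → Pairs n → (Pairs n → Set) → Res n → Set
  StepOK R C₀ C Cov (running C′)    = WellFormed R C′ × Grows C₀ C C′ × Cov C′
  StepOK R C₀ C Cov (returned C′ _) = WellFormed R C′ × Grows C₀ C C′ × ⊤ ∈ sets C′

  stepOK-final : ∀ {R C₀ C Cov} res → StepOK R C₀ C Cov res → WellFormed R (final res) × Grows C₀ C (final res)
  stepOK-final (running _)    (wf , gr , _) = wf , gr
  stepOK-final (returned _ _) (wf , gr , _) = wf , gr

  sequence : ∀ {R C₀ C C₁ Cov₁ Cov₂ Cov} res → StepOK R C₀ C Cov₁ (running C₁) → StepOK R C₀ C₁ Cov₂ res →
             (Cov₁ C₁ → ∀ {C′} → C₁ ⊆ₗ C′ → Cov₂ C′ → Cov C′) → StepOK R C₀ C Cov res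
  sequence (running C′)    (_ , gr₁ , cov₁) (wf , gr₂ , cov₂) combine = wf , grows-trans gr₁ gr₂ , combine cov₁ (proj₁ gr₂) cov₂
  sequence (returned C′ _) (_ , gr₁ , _)    (wf , gr₂ , full) combine = wf , grows-trans gr₁ gr₂ , full

  blocks : ℕ → Subset n → Subset n × ℕ → Bool
  blocks R S′ x = eqSub (proj₁ x) S′ ∧ (proj₂ x ≤ᵇ R)

  data TryAdd (R : ℕ) (p : Subset n × ℕ) (v : Fin n) (C : Pairs n) : Res n → Set where
    skipped  : (proj₂ (extend p v) ≤ R → Any (λ x → blocks R (proj₁ (extend p v)) x ≡ true) C) →
               TryAdd R p v C (running C)
    added    : proj₂ (extend p v) ≤ R → All (λ x → blocks R (proj₁ (extend p v)) x ≡ false) C →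
               TryAdd R p v C (running (C ++ [ extend p v ]))
    finished : proj₂ (extend p v) ≤ R → All (λ x → blocks R (proj₁ (extend p v)) x ≡ false) C →
               proj₁ (extend p v) ≡ ⊤ → TryAdd R p v C (returned (C ++ [ extend p v ]) (proj₂ (extend p v)))

  tryAdd-cases : ∀ R p v C → TryAdd R p v C (tryAdd G R p v C)
  tryAdd-cases R p v C = analyse _ _ refl (λ _ → refl)
    where
      S′ = proj₁ (extend p v)
      r′ = proj₂ (extend p v)
      -- the membership test of tryAdd, abstracted so that it can be analysed
      analyse : (test : Subset n × ℕ → Bool) (a : Bool) → a ≡ anyL test C → (∀ x → test x ≡ blocks R S′ x) →
                TryAdd R p v C (if (r′ ≤ᵇ R) ∧ not a
                                then (if eqSub S′ ⊤ then returned (C ++ [ extend p v ]) r′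
                                      else running (C ++ [ extend p v ]))
                                else running C)
      analyse test a a≡ same with r′ ≤ᵇ R in le | a
      ... | false | _    = skipped (λ h → ⊥-elim (true≢false (≤ᵇ-complete h) le))
      ... | true  | true = skipped (λ _ → Any.map (λ {x} e → trans (≡-sym (same x)) e) (anyL-true test C (≡-sym a≡)))
      ... | true  | false with eqSub S′ ⊤ in full
      ...   | true  = finished (≤ᵇ-sound le) free (eqSub-sound S′ ⊤ full)
        where free = All.map (λ {x} e → trans (≡-sym (same x)) e) (anyL-false test C (≡-sym a≡))
      ...   | false = added (≤ᵇ-sound le) free
        where free = All.map (λ {x} e → trans (≡-sym (same x)) e) (anyL-false test C (≡-sym a≡))

  blocked-present : ∀ {R S′} (C : Pairs n) → Any (λ x → blocks R S′ x ≡ true) C → S′ ∈ sets C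
  blocked-present C b with find b
  ... | x , x∈ , e = subst (_∈ sets C) (eqSub-sound _ _ (∧-trueˡ e)) (∈-map⁺ proj₁ x∈)

  unblocked-fresh : ∀ {R S′} (C : Pairs n) → All (λ x → proj₂ x ≤ R) C → All (λ x → blocks R S′ x ≡ false) C →
                    All (_≢ S′) (sets C)
  unblocked-fresh []      []             []          = []
  unblocked-fresh (x ∷ C) (r≤R ∷ ranks) (fx ∷ free) =
    (λ { refl → true≢false (∧-true (eqSub-refl (proj₁ x)) (≤ᵇ-complete r≤R)) fx }) ∷ unblocked-fresh C ranks free

  append-ok : ∀ {R C₀ C p} v → p ∈ C₀ → WellFormed R C → proj₂ (extend p v) ≤ R →
              All (λ x → blocks R (proj₁ (extend p v)) x ≡ false) C →
              WellFormed R (C ++ [ extend p v ]) × Grows C₀ C (C ++ [ extend p v ]) ×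
              proj₁ (extend p v) ∈ sets (C ++ [ extend p v ])
  append-ok {C = C} {p} v p∈ (distinct , ranks) le free =
    (subst Unique (≡-sym (List.map-++ proj₁ C _))
       (Unique.++⁺ distinct ([] ∷ []) (λ { (y∈ , here refl) → All.lookup (unblocked-fresh C ranks free) y∈ refl })) ,
     All.++⁺ ranks (le ∷ [])) ,
    (∈-++⁺ˡ , origin) ,
    ∈-map⁺ proj₁ (∈-++⁺ʳ C (here refl))
    where
      origin : ∀ {x} → x ∈ C ++ [ extend p v ] → x ∈ C ⊎ Generated _ x
      origin x∈ with ∈-++⁻ C x∈
      ... | inj₁ x∈C         = inj₁ x∈C
      ... | inj₂ (here refl) = inj₂ (p , v , p∈ , refl)

  covers-single : ∀ {R p v C′} → (proj₂ (extend p v) ≤ R → proj₁ (extend p v) ∈ sets C′) → Covers R [ p ] [ v ] C′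
  covers-single h (here refl) (here refl) le = h le
  covers-single h (here refl) (there ())  le
  covers-single h (there ())  _           le

  tryAdd-ok : ∀ R C₀ p v C → p ∈ C₀ → WellFormed R C → StepOK R C₀ C (Covers R [ p ] [ v ]) (tryAdd G R p v C)
  tryAdd-ok R C₀ p v C p∈ wf with tryAdd G R p v C | tryAdd-cases R p v C
  ... | _ | skipped b = wf , grows-refl , covers-single (λ le → blocked-present C (b le))
  ... | _ | added le free =
    let (wf′ , gr , new∈) = append-ok v p∈ wf le free in wf′ , gr , covers-single (λ _ → new∈)
  ... | _ | finished le free full =
    let (wf′ , gr , new∈) = append-ok v p∈ wf le free in wf′ , gr , subst (λ W → W ∈ sets (C ++ [ extend p v ])) full new∈

  covers-∷ᵥ : ∀ {R p v vs C₁} → Covers R [ p ] [ v ] C₁ → ∀ {C′} → C₁ ⊆ₗ C′ → Covers R [ p ] vs C′ →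
              Covers R [ p ] (v ∷ vs) C′
  covers-∷ᵥ cov₁ sub cov₂ p∈ (here refl) le = covers-mono sub cov₁ p∈ (here refl) le
  covers-∷ᵥ cov₁ sub cov₂ p∈ (there v∈)  le = cov₂ p∈ v∈ le

  covers-∷ₚ : ∀ {R p ps vs C₁} → Covers R [ p ] vs C₁ → ∀ {C′} → C₁ ⊆ₗ C′ → Covers R ps vs C′ →
              Covers R (p ∷ ps) vs C′
  covers-∷ₚ cov₁ sub cov₂ (here refl) v∈ le = covers-mono sub cov₁ (here refl) v∈ le
  covers-∷ₚ cov₁ sub cov₂ (there p∈)  v∈ le = cov₂ p∈ v∈ le

  loopV-ok : ∀ R C₀ p vs C → p ∈ C₀ → WellFormed R C → StepOK R C₀ C (Covers R [ p ] vs) (loopV G R p vs C)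
  loopV-ok R C₀ p []       C p∈ wf = wf , grows-refl , λ _ ()
  loopV-ok R C₀ p (v ∷ vs) C p∈ wf with tryAdd G R p v C | tryAdd-ok R C₀ p v C p∈ wf
  ... | returned C₁ _ | ok = ok
  ... | running C₁    | ok = sequence {Cov₁ = Covers R [ p ] [ v ]} {Cov₂ = Covers R [ p ] vs} (loopV G R p vs C₁)
                               ok (loopV-ok R C₀ p vs C₁ p∈ (proj₁ ok)) covers-∷ᵥ

  loopC-ok : ∀ R C₀ ps C → ps ⊆ₗ C₀ → WellFormed R C → StepOK R C₀ C (Covers R ps (allFin n)) (loopC G R ps C)
  loopC-ok R C₀ []       C sub wf = wf , grows-refl , λ ()
  loopC-ok R C₀ (p ∷ ps) C sub wf with loopV G R p (allFin n) C | loopV-ok R C₀ p (allFin n) C (sub (here refl)) wf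
  ... | returned C₁ _ | ok = ok
  ... | running C₁    | ok = sequence {Cov₁ = Covers R [ p ] (allFin n)} {Cov₂ = Covers R ps (allFin n)} (loopC G R ps C₁)
                               ok (loopC-ok R C₀ ps C₁ (λ x∈ → sub (there x∈)) (proj₁ ok)) covers-∷ₚ

  step-ok : ∀ R C₀ → WellFormed R C₀ → StepOK R C₀ C₀ (Covers R C₀ (allFin n)) (step G R C₀)
  step-ok R C₀ = loopC-ok R C₀ C₀ C₀ (λ x∈ → x∈)

  run-induction : (P : ℕ → Res n → Set) → P 0 (runSteps G 0) →
                  (∀ s C → P s (running C) → P (suc s) (step G (suc s) C)) →
                  (∀ s C r → P s (returned C r) → P (suc s) (returned C r)) →
                  ∀ s → P s (runSteps G s)
  run-induction P base next frozen zero = base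
  run-induction P base next frozen (suc s) with runSteps G s | run-induction P base next frozen s
  ... | running C    | h = next s C h
  ... | returned C r | h = frozen s C r h

unique-⊆-length : ∀ {A : Set} (xs ys : List A) → Unique xs → xs ⊆ₗ ys → length xs ≤ length ys
unique-⊆-length []       ys _            _   = z≤n
unique-⊆-length (x ∷ xs) ys (x∉xs ∷ uxs) sub with ∈-∃++ (sub (here refl))
... | as , bs , refl = subst (suc (length xs) ≤_) (≡-sym (List.length-++-sucʳ as x bs))
                         (s≤s (unique-⊆-length xs (as ++ bs) uxs sub′))
  where
    sub′ : xs ⊆ₗ as ++ bs
    sub′ {y} y∈ with ∈-++⁻ as (sub (there y∈))
    ... | inj₁ l            = ∈-++⁺ˡ l
    ... | inj₂ (here y≡x)   = ⊥-elim (All.lookup x∉xs y∈ (≡-sym y≡x))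
    ... | inj₂ (there r)    = ∈-++⁺ʳ as r

subsetsOfSize : (n k : ℕ) → List (Subset n)
subsetsOfSize zero    zero    = [ [] ]
subsetsOfSize zero    (suc k) = []
subsetsOfSize (suc n) zero    = map (false ∷_) (subsetsOfSize n zero)
subsetsOfSize (suc n) (suc k) = map (false ∷_) (subsetsOfSize n (suc k)) ++ map (true ∷_) (subsetsOfSize n k)

length-subsetsOfSize : ∀ n k → length (subsetsOfSize n k) ≡ n choose k
length-subsetsOfSize zero    zero    = refl
length-subsetsOfSize zero    (suc k) = refl
length-subsetsOfSize (suc n) zero    = trans (List.length-map _ (subsetsOfSize n zero)) (length-subsetsOfSize n zero)
length-subsetsOfSize (suc n) (suc k) = begin
  length (map (false ∷_) (subsetsOfSize n (suc k)) ++ map (true ∷_) (subsetsOfSize n k))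
    ≡⟨ List.length-++ (map (false ∷_) (subsetsOfSize n (suc k))) ⟩
  length (map (false ∷_) (subsetsOfSize n (suc k))) + length (map (true ∷_) (subsetsOfSize n k))
    ≡⟨ cong₂ _+_ (List.length-map _ (subsetsOfSize n (suc k))) (List.length-map _ (subsetsOfSize n k)) ⟩
  length (subsetsOfSize n (suc k)) + length (subsetsOfSize n k)
    ≡⟨ cong₂ _+_ (length-subsetsOfSize n (suc k)) (length-subsetsOfSize n k) ⟩
  n choose suc k + n choose k
    ≡⟨ +-comm (n choose suc k) (n choose k) ⟩
  n choose k + n choose suc k
    ≡⟨ nCk+nC[k+1]≡[n+1]C[k+1] n k ⟩
  suc n choose suc k ∎
  where open ≡-Reasoning

subsetsOfSize-complete : ∀ {n} (T : Subset n) → T ∈ subsetsOfSize n ∣ T ∣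
subsetsOfSize-complete []          = here refl
subsetsOfSize-complete {suc n} (false ∷ T) with ∣ T ∣ | subsetsOfSize-complete T
... | zero  | T∈ = ∈-map⁺ (false ∷_) T∈
... | suc k | T∈ = ∈-++⁺ˡ (∈-map⁺ (false ∷_) T∈)
subsetsOfSize-complete {suc n} (true ∷ T) =
  ∈-++⁺ʳ (map (false ∷_) (subsetsOfSize n (suc ∣ T ∣))) (∈-map⁺ (true ∷_) (subsetsOfSize-complete T))

subsetsOfSize-sound : ∀ n k (T : Subset n) → T ∈ subsetsOfSize n k → ∣ T ∣ ≡ k
subsetsOfSize-sound zero    zero    [] _ = refl
subsetsOfSize-sound (suc n) zero    T T∈ with ∈-map⁻ (false ∷_) T∈
... | T₀ , T₀∈ , refl = subsetsOfSize-sound n zero T₀ T₀∈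
subsetsOfSize-sound (suc n) (suc k) T T∈ with ∈-++⁻ (map (false ∷_) (subsetsOfSize n (suc k))) T∈
... | inj₁ T∈₁ with ∈-map⁻ (false ∷_) T∈₁
...   | T₀ , T₀∈ , refl = subsetsOfSize-sound n (suc k) T₀ T₀∈
subsetsOfSize-sound (suc n) (suc k) T T∈ | inj₂ T∈₂ with ∈-map⁻ (true ∷_) T∈₂
...   | T₀ , T₀∈ , refl = cong suc (subsetsOfSize-sound n k T₀ T₀∈)

subsetsOfSize-unique : ∀ n k → Unique (subsetsOfSize n k)
subsetsOfSize-unique zero    zero    = [] ∷ []
subsetsOfSize-unique zero    (suc k) = []
subsetsOfSize-unique (suc n) zero    = Unique.map⁺ ∷-injectiveʳ (subsetsOfSize-unique n zero)
subsetsOfSize-unique (suc n) (suc k) =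
  Unique.++⁺ (Unique.map⁺ ∷-injectiveʳ (subsetsOfSize-unique n (suc k))) (Unique.map⁺ ∷-injectiveʳ (subsetsOfSize-unique n k))
             disjoint
  where
    disjoint : ∀ {T} → ¬ (T ∈ map (false ∷_) (subsetsOfSize n (suc k)) × T ∈ map (true ∷_) (subsetsOfSize n k))
    disjoint (a , b) with ∈-map⁻ (false ∷_) a | ∈-map⁻ (true ∷_) b
    ... | _ , _ , refl | _ , _ , ()

subsetsUpTo : (n s : ℕ) → List (Subset n)
subsetsUpTo n zero    = subsetsOfSize n zero
subsetsUpTo n (suc s) = subsetsUpTo n s ++ subsetsOfSize n (suc s)

length-subsetsUpTo : ∀ n s → length (subsetsUpTo n s) ≡ 1 + binomSum n s
length-subsetsUpTo n zero    = length-subsetsOfSize n zero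
length-subsetsUpTo n (suc s) = begin
  length (subsetsUpTo n s ++ subsetsOfSize n (suc s))          ≡⟨ List.length-++ (subsetsUpTo n s) ⟩
  length (subsetsUpTo n s) + length (subsetsOfSize n (suc s))  ≡⟨ cong₂ _+_ (length-subsetsUpTo n s) (length-subsetsOfSize n (suc s)) ⟩
  (1 + binomSum n s) + n choose suc s                          ≡⟨ +-assoc 1 (binomSum n s) _ ⟩
  1 + binomSum n (suc s)                                       ∎
  where open ≡-Reasoning

subsetsUpTo-complete : ∀ n s (T : Subset n) → ∣ T ∣ ≤ s → T ∈ subsetsUpTo n s
subsetsUpTo-complete n zero    T h = subst (λ k → T ∈ subsetsOfSize n k) (n≤0⇒n≡0 h) (subsetsOfSize-complete T)
subsetsUpTo-complete n (suc s) T h with m≤n⇒m<n∨m≡n h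
... | inj₁ (s≤s lt) = ∈-++⁺ˡ (subsetsUpTo-complete n s T lt)
... | inj₂ eq       = ∈-++⁺ʳ (subsetsUpTo n s) (subst (λ k → T ∈ subsetsOfSize n k) eq (subsetsOfSize-complete T))

subsetsUpTo-sound : ∀ n s (T : Subset n) → T ∈ subsetsUpTo n s → ∣ T ∣ ≤ s
subsetsUpTo-sound n zero    T T∈ = ≤-reflexive (subsetsOfSize-sound n zero T T∈)
subsetsUpTo-sound n (suc s) T T∈ with ∈-++⁻ (subsetsUpTo n s) T∈
... | inj₁ l = m≤n⇒m≤1+n (subsetsUpTo-sound n s T l)
... | inj₂ r = ≤-reflexive (subsetsOfSize-sound n (suc s) T r)

subsetsUpTo-unique : ∀ n s → Unique (subsetsUpTo n s)
subsetsUpTo-unique n zero    = subsetsOfSize-unique n zero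
subsetsUpTo-unique n (suc s) = Unique.++⁺ (subsetsUpTo-unique n s) (subsetsOfSize-unique n (suc s))
  (λ (a , b) → <⇒≱ (s≤s (subsetsUpTo-sound n s _ a)) (≤-reflexive (≡-sym (subsetsOfSize-sound n (suc s) _ b))))

module UpperBound {n : ℕ} (G : Graph n) where
  open Closure G
  open Step G

  Witnessed : Subset n × ℕ → Set
  Witnessed x = Σ (Subset n) λ T → ∣ T ∣ ≤ proj₂ x × cl G T ≡ proj₁ x

  generated-witnessed : ∀ {C₀ x} → All Witnessed C₀ → Generated C₀ x → Witnessed x
  generated-witnessed wit ((S , r) , v , p∈ , refl) with All.lookup wit p∈
  ... | T , T≤r , refl with witness T v
  ...   | A , A≤ , cl≡ = T ∪ A , size , cl≡
    where
      size : ∣ T ∪ A ∣ ≤ cost G (cl G T) r v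
      size = ≤-trans (∣∪∣≤ T A) (subst (∣ T ∣ + ∣ A ∣ ≤_) (≡-sym (cost≡ (cl G T) r v)) (+-mono-≤ T≤r A≤))

  grows-witnessed : ∀ {C₀ C′} → Grows C₀ C₀ C′ → All Witnessed C₀ → All Witnessed C′
  grows-witnessed (_ , origin) wit = All.tabulate λ x∈ → from (origin x∈)
    where
      from : ∀ {x} → x ∈ _ ⊎ Generated _ x → Witnessed x
      from (inj₁ x∈) = All.lookup wit x∈
      from (inj₂ g)  = generated-witnessed wit g

  Invariant : ℕ → Res n → Set
  Invariant s res = WellFormed s (final res) × All Witnessed (final res)

  invariant : ∀ s → Invariant s (runSteps G s)
  invariant = run-induction Invariant initial next frozen
    where
      initial : Invariant 0 (runSteps G 0)
      initial = (([] ∷ []) , (z≤n ∷ [])) , ((⊥ , ≤-reflexive (∣⊥∣≡0 n) , cl-⊥) ∷ [])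
      next : ∀ s C → Invariant s (running C) → Invariant (suc s) (step G (suc s) C)
      next s C (wf , wit) with stepOK-final (step G (suc s) C) (step-ok (suc s) C (WellFormed-suc wf))
      ... | wf′ , grows = wf′ , grows-witnessed grows wit
      frozen : ∀ s C r → Invariant s (returned C r) → Invariant (suc s) (returned C r)
      frozen s C r (wf , wit) = WellFormed-suc wf , wit

  -- the sets of 𝒞 at step s are distinct closures of subsets of size at most s
  upper-bound : ∀ s → length (𝒞-at G s) ≤ 1 + binomSum n s
  upper-bound s rewrite 𝒞-at≡final s with invariant s
  ... | (distinct , ranks) , wit = begin
    length C                          ≡⟨ ≡-sym (List.length-map proj₁ C) ⟩
    length (sets C)                   ≤⟨ unique-⊆-length (sets C) (map (cl G) (subsetsUpTo n s)) distinct closures ⟩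
    length (map (cl G) (subsetsUpTo n s)) ≡⟨ List.length-map (cl G) (subsetsUpTo n s) ⟩
    length (subsetsUpTo n s)          ≡⟨ length-subsetsUpTo n s ⟩
    1 + binomSum n s                  ∎
    where
      open ≤-Reasoning
      C = final (runSteps G s)
      closures : sets C ⊆ₗ map (cl G) (subsetsUpTo n s)
      closures S∈ with ∈-map⁻ proj₁ S∈
      ... | x , x∈ , refl with All.lookup wit x∈
      ...   | T , T≤r , cl≡ = subst (_∈ map (cl G) (subsetsUpTo n s)) cl≡
                (∈-map⁺ (cl G) (subsetsUpTo-complete n s T (≤-trans T≤r (All.lookup ranks x∈))))

edgeless : (n : ℕ) → Graph n
edgeless n = record { adj = λ _ _ → false ; sym = λ _ _ → refl ; irrefl = λ _ → refl }

module Edgeless (n : ℕ) where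
  open Closure (edgeless n)
  open Step (edgeless n)

  cl-id : (X : Subset n) → cl (edgeless n) X ≡ X
  cl-id X = iterate-closed n X (subset-ext λ u → begin
    lookup (forceRound (edgeless n) X) u ≡⟨ lookup-forceRound X u ⟩
    lookup X u ∨ anyFin (forces X u)    ≡⟨ cong (lookup X u ∨_) (anyFin-false (forces X u) (λ w → ∧-zeroʳ (lookup X w))) ⟩
    lookup X u ∨ false                  ≡⟨ ∨-identityʳ (lookup X u) ⟩
    lookup X u                          ∎)
    where open ≡-Reasoning

  lookup-extend : ∀ (p : Subset n × ℕ) v i → lookup (proj₁ (extend p v)) i ≡ (lookup (proj₁ p) i ∨ eqFin i v)
  lookup-extend (S , r) v i = begin
    lookup (cl (edgeless n) (S ∪ N[ edgeless n ] v)) i ≡⟨ cong (λ W → lookup W i) (cl-id (S ∪ N[ edgeless n ] v)) ⟩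
    lookup (S ∪ N[ edgeless n ] v) i                  ≡⟨ lookup-∪ S _ i ⟩
    lookup S i ∨ lookup (N[ edgeless n ] v) i         ≡⟨ cong (lookup S i ∨_) (lookup-N[] v i) ⟩
    lookup S i ∨ eqFin i v                            ∎
    where open ≡-Reasoning

  rank-extend : ∀ (p : Subset n × ℕ) v → proj₂ (extend p v) ≡ proj₂ p + ind (not (lookup (proj₁ p) v))
  rank-extend (S , r) v = begin
    cost (edgeless n) S r v                                          ≡⟨ cost≡ S r v ⟩
    r + ((if lookup S v then 0 else 1) + (∣ N⟨ edgeless n ⟩ v ∩ ∁ S ∣ ∸ 1))
      ≡⟨ cong (λ m → r + ((if lookup S v then 0 else 1) + (m ∸ 1))) (trans (∣uncoloured∣ v S) (count-false {n})) ⟩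
    r + ((if lookup S v then 0 else 1) + 0)                          ≡⟨ cong (r +_) (trans (+-identityʳ _) (≡-sym (ind-not (lookup S v)))) ⟩
    r + ind (not (lookup S v))                                       ∎
    where open ≡-Reasoning

  size-extend : ∀ (p : Subset n × ℕ) v → ∣ proj₁ (extend p v) ∣ ≡ ∣ proj₁ p ∣ + ind (not (lookup (proj₁ p) v))
  size-extend (S , r) v = +-cancelʳ-≡ 0 _ _ (begin
    ∣ S′ ∣ + 0
      ≡⟨ cong₂ _+_ (∣∣≡count S′) (≡-sym (count-false {n})) ⟩
    count (lookup S′) + count {n} (λ _ → false)
      ≡⟨ count-additive {g = λ _ → false} (λ i →
           trans (cong (λ b → ind b + 0) (lookup-extend (S , r) v i)) (ind-∨ (lookup S i) (eqFin i v))) ⟩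
    count (lookup S) + count (λ i → eqFin i v ∧ not (lookup S i))
      ≡⟨ cong₂ _+_ (≡-sym (∣∣≡count S)) (count-single v (λ i → not (lookup S i))) ⟩
    ∣ S ∣ + ind (not (lookup S v))
      ≡⟨ +-identityʳ _ ⟨
    ∣ S ∣ + ind (not (lookup S v)) + 0 ∎)
    where
      open ≡-Reasoning
      S′ = proj₁ (extend (S , r) v)
      ind-∨ : ∀ a b → ind (a ∨ b) + 0 ≡ ind a + ind (b ∧ not a)
      ind-∨ true  true  = refl
      ind-∨ true  false = refl
      ind-∨ false true  = refl
      ind-∨ false false = refl

  Exact : Subset n × ℕ → Set
  Exact x = proj₂ x ≡ ∣ proj₁ x ∣

  grows-exact : ∀ {C₀ C′} → Grows C₀ C₀ C′ → All Exact C₀ → All Exact C′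
  grows-exact (_ , origin) exact = All.tabulate λ x∈ → from (origin x∈)
    where
      from : ∀ {x} → x ∈ _ ⊎ Generated _ x → Exact x
      from (inj₁ x∈) = All.lookup exact x∈
      from (inj₂ (p , v , p∈ , refl)) =
        trans (rank-extend p v) (trans (cong (_+ _) (All.lookup exact p∈)) (≡-sym (size-extend p v)))

  remove-vertex : ∀ s (T : Subset n) → ∣ T ∣ ≡ suc s →
                  Σ (Subset n) λ T₀ → Σ (Fin n) λ v →
                    ∣ T₀ ∣ ≡ s × proj₁ (extend (T₀ , s) v) ≡ T × proj₂ (extend (T₀ , s) v) ≡ suc s
  remove-vertex s T size = T₀ , v , size₀ , set , trans (rank-extend (T₀ , s) v) (trans (cong (λ b → s + ind (not b)) v∉T₀) (+-comm s 1))
    where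
      v = proj₁ (count-witness (lookup T) (subst (1 ≤_) (trans (≡-sym size) (∣∣≡count T)) (s≤s z≤n)))
      v∈T = proj₂ (count-witness (lookup T) (subst (1 ≤_) (trans (≡-sym size) (∣∣≡count T)) (s≤s z≤n)))
      t₀ : Fin n → Bool
      t₀ i = lookup T i ∧ not (eqFin i v)
      T₀ = tabulate t₀
      v∉T₀ : lookup T₀ v ≡ false
      v∉T₀ = trans (lookup∘tabulate t₀ v) (trans (cong (λ b → lookup T v ∧ not b) (eqFin-refl v)) (∧-zeroʳ (lookup T v)))
      restore : ∀ a b → (b ≡ true → a ≡ true) → ((a ∧ not b) ∨ b) ≡ a
      restore true  true  h = refl
      restore false true  h = ≡-sym (h refl)
      restore true  false h = refl
      restore false false h = refl
      set : proj₁ (extend (T₀ , s) v) ≡ T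
      set = subset-ext λ i → trans (lookup-extend (T₀ , s) v i) (trans (cong (_∨ eqFin i v) (lookup∘tabulate t₀ i))
              (restore (lookup T i) (eqFin i v) (λ e → subst (λ j → lookup T j ≡ true) (≡-sym (eqFin-sound e)) v∈T)))
      size₀ : ∣ T₀ ∣ ≡ s
      size₀ = suc-injective (begin
        suc ∣ T₀ ∣                           ≡⟨ +-comm 1 ∣ T₀ ∣ ⟩
        ∣ T₀ ∣ + 1                           ≡⟨ cong (λ b → ∣ T₀ ∣ + ind (not b)) v∉T₀ ⟨
        ∣ T₀ ∣ + ind (not (lookup T₀ v))     ≡⟨ size-extend (T₀ , s) v ⟨
        ∣ proj₁ (extend (T₀ , s) v) ∣        ≡⟨ cong ∣_∣ set ⟩
        ∣ T ∣                                ≡⟨ size ⟩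
        suc s                                ∎)
        where open ≡-Reasoning

  Complete : ℕ → Pairs n → Set
  Complete s C = ∀ T → ∣ T ∣ ≤ s → T ∈ sets C

  -- ⊤ has size n, so it can enter an exact collection only at a step R ≥ n
  full-late : ∀ {R C} → WellFormed R C → All Exact C → ⊤ ∈ sets C → n ≤ R
  full-late (_ , ranks) exact ⊤∈ with ∈-map⁻ proj₁ ⊤∈
  ... | x , x∈ , refl = subst (_≤ _) (trans (All.lookup exact x∈) (∣⊤∣≡n n)) (All.lookup ranks x∈)

  complete-step : ∀ {s C C′} → All Exact C → Complete s C → Covers (suc s) C (allFin n) C′ →
                  ∀ T → ∣ T ∣ ≡ suc s → T ∈ sets C′
  complete-step {s} exact complete covers T size with remove-vertex s T size
  ... | T₀ , v , size₀ , set , rank with ∈-map⁻ proj₁ (complete T₀ (≤-reflexive size₀))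
  ...   | (S , r) , p∈ , refl =
    subst (_∈ sets _) set (covers p∈ (∈-allFin v) (≤-reflexive (subst (λ r′ → proj₂ (extend (S , r′) v) ≡ suc s) r≡s rank)))
    where
      r≡s : s ≡ r
      r≡s = trans (≡-sym size₀) (≡-sym (All.lookup exact p∈))

  complete-suc : ∀ {s C C′} → Complete s C → C ⊆ₗ C′ → (∀ T → ∣ T ∣ ≡ suc s → T ∈ sets C′) → Complete (suc s) C′
  complete-suc complete sub layer T T≤ with m≤n⇒m<n∨m≡n T≤
  ... | inj₁ (s≤s T≤s) = Subsetₗ.map⁺ proj₁ sub (complete T T≤s)
  ... | inj₂ eq        = layer T eq

  Invariant : ℕ → Res n → Set
  Invariant s res = s ≤ n → WellFormed s (final res) × All Exact (final res) × Complete s (final res) × Late s res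
    where
      Late : ℕ → Res n → Set
      Late s (running _)    = Unit
      Late s (returned _ _) = n ≤ s

  invariant : ∀ s → Invariant s (runSteps (edgeless n) s)
  invariant = run-induction Invariant initial next frozen
    where
      initial : Invariant 0 (runSteps (edgeless n) 0)
      initial _ = (([] ∷ []) , (z≤n ∷ [])) , (≡-sym (∣⊥∣≡0 n) ∷ []) ,
                  (λ T T≤0 → subst (_∈ sets [ (⊥ , 0) ]) (≡-sym (∣p∣≡0⇒p≡⊥ T T≤0)) (here refl)) , tt
        where
          ∣p∣≡0⇒p≡⊥ : ∀ T → ∣ T ∣ ≤ 0 → T ≡ ⊥
          ∣p∣≡0⇒p≡⊥ T T≤0 = subset-ext λ i →
            trans (count-zero (lookup T) (trans (≡-sym (∣∣≡count T)) (n≤0⇒n≡0 T≤0)) i) (≡-sym (lookup-⊥ i))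
      next : ∀ s C → Invariant s (running C) → Invariant (suc s) (step (edgeless n) (suc s) C)
      next s C inv s<n with inv (≤-trans (n≤1+n s) s<n)
      ... | wf , exact , complete , _
        with step (edgeless n) (suc s) C | step-ok (suc s) C (WellFormed-suc wf)
      ... | running C′ | wf′ , grows , covers =
        wf′ , grows-exact grows exact , complete-suc complete (proj₁ grows) (complete-step exact complete covers) , tt
      ... | returned C′ _ | wf′ , grows , ⊤∈ =
        wf′ , exact′ , complete-suc complete (proj₁ grows) only-⊤ , n≤s+1
        where
          exact′ = grows-exact grows exact
          n≤s+1 = full-late wf′ exact′ ⊤∈
          -- returning at step s + 1 ≤ n forces s + 1 = n, so the only new set is ⊤
          only-⊤ : ∀ T → ∣ T ∣ ≡ suc s → T ∈ sets C′
          only-⊤ T eq = subst (_∈ sets C′) (≡-sym (∣p∣≡n⇒p≡⊤ (trans eq (≤-antisym s<n n≤s+1)))) ⊤∈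
      frozen : ∀ s C r → Invariant s (returned C r) → Invariant (suc s) (returned C r)
      frozen s C r inv s<n with inv (≤-trans (n≤1+n s) s<n)
      ... | _ , _ , _ , n≤s = ⊥-elim (<⇒≱ s<n n≤s)

  lower-bound : ∀ s → s ≤ n → 1 + binomSum n s ≤ length (𝒞-at (edgeless n) s)
  lower-bound s s≤n rewrite 𝒞-at≡final s with invariant s s≤n
  ... | _ , _ , complete , _ = begin
    1 + binomSum n s           ≡⟨ length-subsetsUpTo n s ⟨
    length (subsetsUpTo n s)   ≤⟨ unique-⊆-length (subsetsUpTo n s) (sets C) (subsetsUpTo-unique n s)
                                    (λ T∈ → complete _ (subsetsUpTo-sound n s _ T∈)) ⟩
    length (sets C)            ≡⟨ List.length-map proj₁ C ⟩
    length C                   ∎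
    where
      open ≤-Reasoning
      C = final (runSteps (edgeless n) s)

-- At every step s (1 ≤ s ≤ n) the collection has at most 1 + ∑_{i=1}^{s} C(n,i)
-- pairs (the 1 counting the initial pair (∅ , 0)), and the edgeless graph
-- attains this bound.
theorem2 : (∀ {n : ℕ} (G : Graph n) (s : ℕ) → 1 ≤ s → s ≤ n →
             length (𝒞-at G s) ≤ 1 + binomSum n s)
           × (∀ (n s : ℕ) → 1 ≤ s → s ≤ n →
             Σ (Graph n) (λ G → length (𝒞-at G s) ≡ 1 + binomSum n s))
theorem2 = (λ G s _ _ → UpperBound.upper-bound G s)
         , (λ n s _ s≤n → edgeless n , ≤-antisym (UpperBound.upper-bound (edgeless n) s) (Edgeless.lower-bound n s s≤n))
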